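{- Let $\mathcal M=(M,<,\ldots)$ be a locally weakly o-minimal structure. Then $\mathcal M$ is locally o-minimal.
   Context: All structures are expansions of a dense linear order without endpoints $(M,<)$; "definable" means definable with parameters; $M$ carries the order topology. An open interval is a set $(b_1,b_2)=\{x\in M: b_1<x<b_2\}$ with $b_1,b_2\in M\cup\{\pm\infty\}$. $\mathcal M$ is locally o-minimal if for every definable $X\subseteq M$ and every $a\in M$ there is an open interval $I\ni a$ such that $X\cap I$ is a union of a finite set and finitely many open intervals. $\mathcal M$ is locally weakly o-minimal if for every definable $X\subseteq M$ and every $a\in M$ there is an open interval $I\ni a$ such that $X\cap I$ is a union of a finite set and finitely many open convex sets. -}

module Defs where

open import Data.Empty using (⊥)
open import Data.Unit using (⊤)
open import Data.Nat using (ℕ)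
open import Data.Fin using (Fin)
open import Data.List using (List)
open import Data.List.Membership.Propositional using (_∈_)
open import Data.Product using (Σ; ∃; _×_; _,_)
open import Data.Sum using (_⊎_)
open import Relation.Binary.PropositionalEquality using (_≡_)
open import Relation.Binary.Structures using (IsStrictTotalOrder)
open import Function.Bundles using (_⇔_)

-- An expansion M = (M,<,...) of a dense linear order without endpoints,
-- presented through its carrier, its order, and the class of its
-- definable (with parameters) subsets of M.  Only definable subsets of M
-- itself enter the notions of (weak) local o-minimality.
record DLOExpansion : Set₂ where
  field
    M          : Set
    _<_        : M → M → Set
    isSTO      : IsStrictTotalOrder _≡_ _<_
    dense      : ∀ {x y} → x < y → ∃ λ z → (x < z) × (z < y)
    noMin      : ∀ x → ∃ λ y → y < x
    noMax      : ∀ x → ∃ λ y → x < y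
    Definable  : (M → Set) → Set

module _ (S : DLOExpansion) where
  open DLOExpansion S

  data Ext : Set where
    -∞  : Ext
    +∞  : Ext
    ⟨_⟩ : M → Ext

  Above : Ext → M → Set
  Above -∞    x = ⊤
  Above +∞    x = ⊥
  Above ⟨ b ⟩ x = b < x

  Below : M → Ext → Set
  Below x -∞    = ⊥
  Below x +∞    = ⊤
  Below x ⟨ b ⟩ = x < b

  OpenInterval : Ext → Ext → M → Set
  OpenInterval b₁ b₂ x = Above b₁ x × Below x b₂

  Convex : (M → Set) → Set
  Convex C = ∀ {x y z} → C x → C z → x < y → y < z → C y

  Open : (M → Set) → Set
  Open C = ∀ x → C x → Σ Ext λ b₁ → Σ Ext λ b₂ →
             OpenInterval b₁ b₂ x × (∀ y → OpenInterval b₁ b₂ y → C y)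

  FinUnionIntervals : (M → Set) → Set
  FinUnionIntervals Y = Σ (List M) λ F → Σ ℕ λ n →
      Σ (Fin n → Ext) λ l → Σ (Fin n → Ext) λ r →
        ∀ x → Y x ⇔ ((x ∈ F) ⊎ (∃ λ i → OpenInterval (l i) (r i) x))

  FinUnionOpenConvex : (M → Set) → Set₁
  FinUnionOpenConvex Y = Σ (List M) λ F → Σ ℕ λ n →
      Σ (Fin n → M → Set) λ C →
        (∀ i → Open (C i) × Convex (C i)) ×
        (∀ x → Y x ⇔ ((x ∈ F) ⊎ (∃ λ i → C i x)))

  LocallyOMinimal : Set₁
  LocallyOMinimal = ∀ (X : M → Set) → Definable X → ∀ a →
    Σ Ext λ b₁ → Σ Ext λ b₂ → OpenInterval b₁ b₂ a ×
      FinUnionIntervals (λ x → X x × OpenInterval b₁ b₂ x)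

  LocallyWeaklyOMinimal : Set₁
  LocallyWeaklyOMinimal = ∀ (X : M → Set) → Definable X → ∀ a →
    Σ Ext λ b₁ → Σ Ext λ b₂ → OpenInterval b₁ b₂ a ×
      FinUnionOpenConvex (λ x → X x × OpenInterval b₁ b₂ x)

-- Near a, X is a finite set F together with a finite union U of convex sets.  A convex
-- set either holds on a whole interval (c , a) or fails on one: if it meets every (c , a),
-- convexity fills the gaps between the points found.  The dichotomy passes to finite
-- unions and, by symmetry, holds on the right of a.  Shrinking to avoid F, X ∩ (c , d) is
-- therefore ({a} or ∅) ∪ ((c , a) or ∅) ∪ ((a , d) or ∅).
module Submission where

open import Defs
open import Level using (Level; 0ℓ)
open import Axiom.ExcludedMiddle using (ExcludedMiddle)
open import Data.Empty using (⊥-elim)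
open import Data.Unit using (tt)
open import Data.Nat using (zero; suc)
open import Data.Fin using (Fin; zero; suc)
open import Data.Fin.Properties using (⊎⇔∃)
open import Data.List using (List; []; _∷_)
open import Data.List.Relation.Unary.Any using (here; there)
open import Data.List.Membership.Propositional using (_∈_; _∉_)
open import Data.Product using (Σ; ∃; _×_; _,_; proj₁; proj₂)
open import Data.Sum using (_⊎_; inj₁; inj₂; [_,_])
open import Function.Base using (_∘_)
open import Function.Bundles using (_⇔_; mk⇔; Equivalence)
open import Relation.Binary.PropositionalEquality using (_≡_; _≢_; refl; subst)
open import Relation.Binary.Structures using (IsStrictTotalOrder)
open import Relation.Binary.Definitions using (tri<; tri≈; tri>)
import Relation.Binary.Construct.Flip.EqAndOrd as Flip
open import Relation.Nullary using (¬_; Dec; yes; no; contradiction)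
open import Relation.Unary using (_∩_)

-- Left germs at a; the right germs are those of the reversed order.
module OneSidedGerm {M : Set} {_<_ : M → M → Set}
  (isSTO : IsStrictTotalOrder _≡_ _<_) (noMin : ∀ x → ∃ λ y → y < x) where

  open IsStrictTotalOrder isSTO using (trans; irrefl; compare; _<?_)

  IsConvex : (M → Set) → Set
  IsConvex C = ∀ {x y z} → C x → C z → x < y → y < z → C y

  module _ (a : M) where

    Eventually : (M → Set) → Set
    Eventually P = ∃ λ c → c < a × (∀ y → c < y → y < a → P y)

    Frequently : (M → Set) → Set
    Frequently P = ∀ c → c < a → ∃ λ y → c < y × y < a × P y

    Decided : (M → Set) → Set
    Decided P = Eventually P ⊎ Eventually (¬_ ∘ P)

    eventually-mono : ∀ {P Q : M → Set} → Eventually P → (∀ y → P y → Q y) → Eventually Q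
    eventually-mono (c , c<a , p) f = c , c<a , λ y c<y y<a → f y (p y c<y y<a)

    eventually-always : ∀ {P : M → Set} → (∀ y → P y) → Eventually P
    eventually-always p = let (c , c<a) = noMin a in c , c<a , λ y _ _ → p y

    eventually-∧ : ∀ {P Q : M → Set} → Eventually P → Eventually Q → Eventually (P ∩ Q)
    eventually-∧ (c₁ , c₁<a , p) (c₂ , c₂<a , q) with compare c₁ c₂
    ... | tri< c₁<c₂ _ _ = c₂ , c₂<a , λ y c₂<y y<a → p y (trans c₁<c₂ c₂<y) y<a , q y c₂<y y<a
    ... | tri≈ _ refl _  = c₁ , c₁<a , λ y c₁<y y<a → p y c₁<y y<a , q y c₁<y y<a
    ... | tri> _ _ c₂<c₁ = c₁ , c₁<a , λ y c₁<y y<a → p y c₁<y y<a , q y (trans c₂<c₁ c₁<y) y<a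

    eventually-≢ : ∀ f → Eventually (_≢ f)
    eventually-≢ f with f <? a
    ... | yes f<a = f , f<a , λ y f<y _ y≡f → irrefl refl (subst (f <_) y≡f f<y)
    ... | no f≮a  = let (c , c<a) = noMin a in
                    c , c<a , λ y _ y<a y≡f → f≮a (subst (_< a) y≡f y<a)

    eventually-∉ : ∀ F → Eventually (_∉ F)
    eventually-∉ []      = eventually-always λ _ ()
    eventually-∉ (f ∷ F) = eventually-mono (eventually-∧ (eventually-≢ f) (eventually-∉ F)) ∉∷
      where
      ∉∷ : ∀ y → y ≢ f × y ∉ F → y ∉ f ∷ F
      ∉∷ y (y≢f , _) (here y≡f) = y≢f y≡f
      ∉∷ y (_ , y∉F) (there y∈F) = y∉F y∈F

    ¬eventually¬⇒frequently : ExcludedMiddle 0ℓ → ∀ {P : M → Set} →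
                              ¬ Eventually (¬_ ∘ P) → Frequently P
    ¬eventually¬⇒frequently em {P} ¬ev c c<a with em {∃ λ y → c < y × y < a × P y}
    ... | yes p = p
    ... | no ¬p = contradiction (c , c<a , λ y c<y y<a Py → ¬p (y , c<y , y<a , Py)) ¬ev

    convex-frequently⇒eventually : ∀ {C : M → Set} → IsConvex C → Frequently C → Eventually C
    convex-frequently⇒eventually {C} convex frequently =
      let (c , c<a) = noMin a
          (y₀ , _ , y₀<a , Cy₀) = frequently c c<a
      in y₀ , y₀<a , fill y₀ Cy₀
      where
      fill : ∀ y₀ → C y₀ → ∀ y → y₀ < y → y < a → C y
      fill y₀ Cy₀ y y₀<y y<a = let (z , y<z , _ , Cz) = frequently y y<a in convex Cy₀ Cz y₀<y y<z

    convex-decided : ExcludedMiddle 0ℓ → ∀ {C : M → Set} → IsConvex C → Decided C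
    convex-decided em {C} convex with em {Eventually (¬_ ∘ C)}
    ... | yes ev¬ = inj₂ ev¬
    ... | no ¬ev¬ = inj₁ (convex-frequently⇒eventually convex (¬eventually¬⇒frequently em ¬ev¬))

    decided-transfer : ∀ {P Q : M → Set} → Eventually (λ y → P y ⇔ Q y) → Decided P → Decided Q
    decided-transfer agree (inj₁ ev) =
      inj₁ (eventually-mono (eventually-∧ agree ev) λ _ (P⇔Q , Py) → Equivalence.to P⇔Q Py)
    decided-transfer agree (inj₂ ev) =
      inj₂ (eventually-mono (eventually-∧ agree ev) λ _ (P⇔Q , ¬Py) → ¬Py ∘ Equivalence.from P⇔Q)

    decided-⊎ : ∀ {P Q : M → Set} → Decided P → Decided Q → Decided (λ y → P y ⊎ Q y)
    decided-⊎ (inj₁ evP) _          = inj₁ (eventually-mono evP λ _ → inj₁)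
    decided-⊎ _          (inj₁ evQ) = inj₁ (eventually-mono evQ λ _ → inj₂)
    decided-⊎ (inj₂ ev¬P) (inj₂ ev¬Q) =
      inj₂ (eventually-mono (eventually-∧ ev¬P ev¬Q) λ _ (¬Py , ¬Qy) → [ ¬Py , ¬Qy ])

    decided-∃ : ∀ {n} {C : Fin n → M → Set} → (∀ i → Decided (C i)) → Decided (λ y → ∃ λ i → C i y)
    decided-∃ {zero}  _       = inj₂ (eventually-always λ _ ())
    decided-∃ {suc n} decided =
      decided-transfer (eventually-always λ _ → ⊎⇔∃)
        (decided-⊎ (decided zero) (decided-∃ (decided ∘ suc)))

module _ (S : DLOExpansion) where
  open DLOExpansion S
  open IsStrictTotalOrder isSTO using (compare) renaming (trans to <-trans)

  module Left  = OneSidedGerm isSTO noMin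
  module Right = OneSidedGerm (Flip.isStrictTotalOrder isSTO) noMax

  Above-<-trans : ∀ {x y} b → Above S b x → x < y → Above S b y
  Above-<-trans -∞    _   _   = tt
  Above-<-trans ⟨ b ⟩ b<x x<y = <-trans b<x x<y

  Below-<-trans : ∀ {x y} b → x < y → Below S y b → Below S x b
  Below-<-trans +∞    _   _   = tt
  Below-<-trans ⟨ b ⟩ x<y y<b = <-trans x<y y<b

  interval-eventually-left : ∀ b₁ b₂ {a} → OpenInterval S b₁ b₂ a →
                             Left.Eventually a (OpenInterval S b₁ b₂)
  interval-eventually-left -∞      b₂ {a} (_ , a<b₂) =
    let (c , c<a) = noMin a in c , c<a , λ _ _ y<a → tt , Below-<-trans b₂ y<a a<b₂
  interval-eventually-left ⟨ b ⟩   b₂     (b<a , a<b₂) =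
    b , b<a , λ _ b<y y<a → b<y , Below-<-trans b₂ y<a a<b₂

  interval-eventually-right : ∀ b₁ b₂ {a} → OpenInterval S b₁ b₂ a →
                              Right.Eventually a (OpenInterval S b₁ b₂)
  interval-eventually-right b₁ +∞    {a} (b₁<a , _) =
    let (d , a<d) = noMax a in d , a<d , λ _ _ a<y → Above-<-trans b₁ b₁<a a<y , tt
  interval-eventually-right b₁ ⟨ b ⟩     (b₁<a , a<b) =
    b , a<b , λ _ y<b a<y → Above-<-trans b₁ b₁<a a<y , y<b

  -- The trace is all of (c , a) or, encoded as (+∞ , a), empty.
  decided-left⇒interval : ∀ {a} {Y : M → Set} → Left.Decided a Y →
    Σ M λ c → c < a × Σ (Ext S) λ l →
      ∀ x → (Y ∩ OpenInterval S ⟨ c ⟩ ⟨ a ⟩) x ⇔ OpenInterval S l ⟨ a ⟩ x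
  decided-left⇒interval (inj₁ (c , c<a , Y-on)) =
    c , c<a , ⟨ c ⟩ , λ x → mk⇔ proj₂ λ x∈ → Y-on x (proj₁ x∈) (proj₂ x∈) , x∈
  decided-left⇒interval (inj₂ (c , c<a , ¬Y-on)) =
    c , c<a , +∞ , λ x → mk⇔ (λ (Yx , c<x , x<a) → ⊥-elim (¬Y-on x c<x x<a Yx)) λ ()

  decided-right⇒interval : ∀ {a} {Y : M → Set} → Right.Decided a Y →
    Σ M λ d → a < d × Σ (Ext S) λ r →
      ∀ x → (Y ∩ OpenInterval S ⟨ a ⟩ ⟨ d ⟩) x ⇔ OpenInterval S ⟨ a ⟩ r x
  decided-right⇒interval (inj₁ (d , a<d , Y-on)) =
    d , a<d , ⟨ d ⟩ , λ x → mk⇔ proj₂ λ x∈ → Y-on x (proj₂ x∈) (proj₁ x∈) , x∈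
  decided-right⇒interval (inj₂ (d , a<d , ¬Y-on)) =
    d , a<d , -∞ , λ x → mk⇔ (λ (Yx , a<x , x<d) → ⊥-elim (¬Y-on x x<d a<x Yx)) λ ()

  finUnionIntervals-around : ∀ {Y : M → Set} {a c d l r} → c < a → a < d →
    (∀ x → (Y ∩ OpenInterval S ⟨ c ⟩ ⟨ a ⟩) x ⇔ OpenInterval S l ⟨ a ⟩ x) →
    (∀ x → (Y ∩ OpenInterval S ⟨ a ⟩ ⟨ d ⟩) x ⇔ OpenInterval S ⟨ a ⟩ r x) →
    Dec (Y a) → FinUnionIntervals S (Y ∩ OpenInterval S ⟨ c ⟩ ⟨ d ⟩)
  finUnionIntervals-around {Y} {a} {c} {d} {l} {r} c<a a<d left right Y?a =
    centre Y?a , 2 , lower , upper , λ x → mk⇔ (split x) (join x)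
    where
    centre : Dec (Y a) → List M
    centre (yes _) = a ∷ []
    centre (no _)  = []

    lower upper : Fin 2 → Ext S
    lower zero    = l
    lower (suc _) = ⟨ a ⟩
    upper zero    = ⟨ a ⟩
    upper (suc _) = r

    centre-∈ : ∀ Y?a → Y a → a ∈ centre Y?a
    centre-∈ (yes _) _  = here refl
    centre-∈ (no ¬Ya) Ya = contradiction Ya ¬Ya

    centre-⊆ : ∀ {x} Y?a → x ∈ centre Y?a → (Y ∩ OpenInterval S ⟨ c ⟩ ⟨ d ⟩) x
    centre-⊆ (yes Ya) (here refl) = Ya , c<a , a<d

    split : ∀ x → (Y ∩ OpenInterval S ⟨ c ⟩ ⟨ d ⟩) x →
            x ∈ centre Y?a ⊎ ∃ λ i → OpenInterval S (lower i) (upper i) x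
    split x (Yx , c<x , x<d) with compare x a
    ... | tri< x<a _ _ = inj₂ (zero , Equivalence.to (left x) (Yx , c<x , x<a))
    ... | tri≈ _ refl _ = inj₁ (centre-∈ Y?a Yx)
    ... | tri> _ _ a<x = inj₂ (suc zero , Equivalence.to (right x) (Yx , a<x , x<d))

    join : ∀ x → x ∈ centre Y?a ⊎ ∃ (λ i → OpenInterval S (lower i) (upper i) x) →
           (Y ∩ OpenInterval S ⟨ c ⟩ ⟨ d ⟩) x
    join x (inj₁ x∈centre) = centre-⊆ Y?a x∈centre
    join x (inj₂ (zero , x∈)) =
      let (Yx , c<x , x<a) = Equivalence.from (left x) x∈ in Yx , c<x , <-trans x<a a<d
    join x (inj₂ (suc zero , x∈)) =
      let (Yx , a<x , x<d) = Equivalence.from (right x) x∈ in Yx , <-trans c<a a<x , x<d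

  agrees-off-finite : ∀ {Y I U : M → Set} {F : List M} →
    (∀ x → (Y ∩ I) x ⇔ (x ∈ F ⊎ U x)) → ∀ y → (I ∩ (_∉ F)) y → U y ⇔ Y y
  agrees-off-finite trace y (Iy , y∉F) = mk⇔
    (λ Uy → proj₁ (Equivalence.from (trace y) (inj₂ Uy)))
    (λ Yy → [ (λ y∈F → contradiction y∈F y∉F) , (λ Uy → Uy) ] (Equivalence.to (trace y) (Yy , Iy)))

  module _ (em : ExcludedMiddle 0ℓ) {Y : M → Set} {a} (b₁ b₂ : Ext S) {F : List M} {n}
           {C : Fin n → M → Set} (a∈I : OpenInterval S b₁ b₂ a) (convex : ∀ i → Convex S (C i))
           (trace : ∀ x → (Y ∩ OpenInterval S b₁ b₂) x ⇔ (x ∈ F ⊎ ∃ λ i → C i x)) where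

    decided-left : Left.Decided a Y
    decided-left = Left.decided-transfer a
      (Left.eventually-mono a
        (Left.eventually-∧ a (interval-eventually-left b₁ b₂ a∈I) (Left.eventually-∉ a F))
        (agrees-off-finite trace))
      (Left.decided-∃ a λ i → Left.convex-decided a em (convex i))

    decided-right : Right.Decided a Y
    decided-right = Right.decided-transfer a
      (Right.eventually-mono a
        (Right.eventually-∧ a (interval-eventually-right b₁ b₂ a∈I) (Right.eventually-∉ a F))
        (agrees-off-finite trace))
      (Right.decided-∃ a λ i → Right.convex-decided a em λ Cx Cz y<x z<y → convex i Cz Cx z<y y<x)

    convex-pieces⇒finUnionIntervals : Σ (Ext S) λ c → Σ (Ext S) λ d → OpenInterval S c d a ×
                                        FinUnionIntervals S (Y ∩ OpenInterval S c d)
    convex-pieces⇒finUnionIntervals =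
      let (c , c<a , l , left)  = decided-left⇒interval decided-left
          (d , a<d , r , right) = decided-right⇒interval decided-right
      in ⟨ c ⟩ , ⟨ d ⟩ , (c<a , a<d) , finUnionIntervals-around {l = l} {r = r} c<a a<d left right em

proposition2p4 : (∀ {ℓ : Level} → ExcludedMiddle ℓ) →
    (S : DLOExpansion) → LocallyWeaklyOMinimal S → LocallyOMinimal S
proposition2p4 em S locallyWeaklyOMinimal X definable a =
  let (b₁ , b₂ , a∈I , _ , _ , _ , open×convex , trace) = locallyWeaklyOMinimal X definable a
  in convex-pieces⇒finUnionIntervals S em b₁ b₂ a∈I (proj₂ ∘ open×convex) trace
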